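{- Let $G$ be a simple connected graph with $n$ vertices and diameter $d$. Then \[ \rho(G)\le (n-d+1)(2^{d-1}-1)+2 . \]
   Context: A pebble distribution on a graph $G$ is a function $p:V(G)\to\mathbb{Z}_{\ge 0}$; its size is $\sum_{v}p(v)$. If $\{v,u\}\in E(G)$, the pebbling move $(v,v\to u)$ removes two pebbles from $v$ and adds one pebble at $u$. If $v\neq w$ and both $v$ and $w$ are adjacent to $u$, the strict rubbling move $(v,w\to u)$ removes one pebble from each of $v$ and $w$ and adds one pebble at $u$. A rubbling move is a pebbling move or a strict rubbling move. A vertex $v$ is reachable from $p$ if there is a finite sequence of rubbling moves, each applied to a distribution with no negative entries (all intermediate distributions nonnegative), after which $v$ has at least one pebble. The rubbling number $\rho(G)$ is the least $m$ such that every vertex of $G$ is reachable from every pebble distribution of size $m$. -}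

module Defs where

open import Data.Nat using (ℕ; zero; suc; _+_; _*_; _∸_; _^_; _≤_; _<_)
open import Data.Fin using (Fin; _≟_)
open import Data.Bool using (if_then_else_)
open import Data.Vec using (tabulate; sum)
open import Data.Product using (Σ; ∃; _×_; _,_)
open import Relation.Nullary using (¬_)
open import Relation.Nullary.Decidable using (⌊_⌋)
open import Relation.Binary.PropositionalEquality using (_≡_)
open import Relation.Binary.Construct.Closure.ReflexiveTransitive using (Star)

record Graph (n : ℕ) : Set₁ where
  field
    Adj   : Fin n → Fin n → Set
    sym   : ∀ {u v} → Adj u v → Adj v u
    irref : ∀ {u} → ¬ Adj u u
open Graph public

module _ {n : ℕ} (G : Graph n) where

  data Walk : Fin n → Fin n → ℕ → Set where
    here : ∀ {u} → Walk u u 0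
    step : ∀ {u w v k} → Adj G u w → Walk w v k → Walk u v (suc k)

  Connected : Set
  Connected = ∀ u v → ∃ λ k → Walk u v k

  Dist : Fin n → Fin n → ℕ → Set
  Dist u v k = Walk u v k × (∀ j → Walk u v j → k ≤ j)

  Diameter : ℕ → Set
  Diameter d = (∀ u v → ∃ λ k → k ≤ d × Dist u v k)
             × (∃ λ u → ∃ λ v → Dist u v d)

  Distribution : Set
  Distribution = Fin n → ℕ

  size : Distribution → ℕ
  size p = sum (tabulate p)

  _at_ : Fin n → Fin n → ℕ
  (x at y) = if ⌊ x ≟ y ⌋ then 1 else 0

  -- One rubbling move transforming p into q (all entries stay nonnegative
  -- thanks to the guards).
  data Move (p q : Distribution) : Set where
    pebbling : ∀ v u → Adj G v u → 2 ≤ p v →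
               (∀ x → q x ≡ (p x ∸ (2 * (x at v))) + (x at u)) → Move p q
    rubbling : ∀ v w u → ¬ v ≡ w → Adj G v u → Adj G w u → 1 ≤ p v → 1 ≤ p w →
               (∀ x → q x ≡ ((p x ∸ (x at v)) ∸ (x at w)) + (x at u)) → Move p q

  Reachable : Distribution → Fin n → Set
  Reachable p v = ∃ λ q → Star Move p q × 1 ≤ q v

  Suffices : ℕ → Set
  Suffices m = ∀ (p : Distribution) → size p ≡ m → ∀ v → Reachable p v

  -- ρ(G) ≤ B  (ρ(G) = least m with Suffices m), i.e. some m ≤ B suffices.
  RubblingNumber≤ : ℕ → Set
  RubblingNumber≤ B = ∃ λ m → m ≤ B × Suffices m

-- Fix the target r, a shortest-path tree towards r, the eccentricity e of r, and give a
-- pebble on v the weight 2 ^ (e ∸ depth v). Moving two pebbles from children of u onto u,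
-- by a pebbling or a strict rubbling move, keeps the total weight and loses a pebble. When
-- no such move exists and r is empty, every u has at most one pebble among its children, so
-- the total weight is at most W = Σ_u ⌊ 2 ^ (e ∸ depth u) /2⌋; hence a distribution of weight
-- above W reaches r. On the tree path from a deepest vertex to r the terms of W add up to
-- 2 ^ e ∸ 1, and each of the other n ∸ (e + 1) vertices contributes at most ⌊ 2 ^ (e ∸ 1) /2⌋.
-- Since weight ≥ size and e ≤ d, the stated bound exceeds W.
module Submission where

open import Data.Empty using (⊥-elim)
open import Data.Fin using (Fin; zero; suc; toℕ; fromℕ; punchIn; punchOut; _≟_)
open import Data.Fin.Properties
  using (any?; injective⇒≤; punchIn-injective; punchInᵢ≢i; punchIn-punchOut; punchOut-injective;
         toℕ-fromℕ; toℕ-injective; toℕ≤pred[n])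
import Data.Fin.Properties as Fin
open import Data.Nat using (ℕ; zero; suc; _+_; _*_; _∸_; _^_; _≤_; _<_; _≤?_; z≤n; s≤s; ⌊_/2⌋)
open import Data.Nat.Induction using (<-wellFounded)
open import Data.Nat.Properties hiding (_≟_)
open import Algebra.Properties.Semiring.Sum +-*-semiring
  using (sum; sum-syntax; ∑-distrib-+; ∑-comm; *-distribˡ-sum; sum-cong-≗; sum-remove; sum-replicate-zero)
open import Data.Nat.Tactic.RingSolver using (solve-∀)
open import Data.Product using (∃; ∃₂; _×_; _,_; proj₁; proj₂)
open import Data.Sum using (_⊎_; inj₁; inj₂)
import Data.Vec as Vec
open import Data.Vec.Functional using (removeAt)
open import Defs hiding (sym)
open import Function using (_∘_)
open import Function.Definitions using (Injective)
open import Induction.WellFounded using (Acc; acc)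
open import Relation.Binary.Construct.Closure.ReflexiveTransitive using (ε; _◅_)
open import Relation.Binary.PropositionalEquality
open import Relation.Nullary using (yes; no)

sum-mono-≤ : ∀ {n} {f g : Fin n → ℕ} → (∀ x → f x ≤ g x) → sum f ≤ sum g
sum-mono-≤ {zero}  f≤g = z≤n
sum-mono-≤ {suc n} f≤g = +-mono-≤ (f≤g zero) (sum-mono-≤ (f≤g ∘ suc))

sum-const : ∀ n c → ∑[ x < n ] c ≡ n * c
sum-const zero    c = refl
sum-const (suc n) c = cong (c +_) (sum-const n c)

sum-tabulate : ∀ {n} (f : Fin n → ℕ) → Vec.sum (Vec.tabulate f) ≡ sum f
sum-tabulate {zero}  f = refl
sum-tabulate {suc n} f = cong (f zero +_) (sum-tabulate (f ∘ suc))

sum-point : ∀ {n} (f : Fin n → ℕ) v → (∀ x → x ≢ v → f x ≡ 0) → sum f ≡ f v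
sum-point {suc n} f v f≡0 = begin
  sum f                     ≡⟨ sum-remove {i = v} f ⟩
  f v + sum (removeAt f v)  ≡⟨ cong (f v +_) (sum-cong-≗ (λ x → f≡0 _ (punchInᵢ≢i v x))) ⟩
  f v + ∑[ x < n ] 0        ≡⟨ cong (f v +_) (sum-replicate-zero n) ⟩
  f v + 0                   ≡⟨ +-identityʳ (f v) ⟩
  f v                       ∎
  where open ≡-Reasoning

sum-transfer : ∀ {n} {f a g b : Fin n → ℕ} → (∀ x → f x + a x ≡ g x + b x) →
               sum f + sum a ≡ sum g + sum b
sum-transfer {n} {f} {a} {g} {b} eq = begin
  sum f + sum a           ≡⟨ ∑-distrib-+ f a ⟨
  ∑[ x < n ] (f x + a x)  ≡⟨ sum-cong-≗ eq ⟩
  ∑[ x < n ] (g x + b x)  ≡⟨ ∑-distrib-+ g b ⟩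
  sum g + sum b           ∎
  where open ≡-Reasoning

sum-≤-image : ∀ {m n} (x : Fin m → Fin n) → Injective _≡_ _≡_ x → (f : Fin n → ℕ) (c : ℕ) →
              (∀ u → (∀ j → x j ≢ u) → f u ≤ c) →
              sum f ≤ ∑[ j < m ] f (x j) + (n ∸ m) * c
sum-≤-image {zero} {n} x _ f c bound = begin
  sum f         ≤⟨ sum-mono-≤ (λ u → bound u λ ()) ⟩
  ∑[ u < n ] c  ≡⟨ sum-const n c ⟩
  n * c         ∎
  where open ≤-Reasoning
sum-≤-image {suc m} {zero} x _ _ _ _ with x zero
... | ()
sum-≤-image {suc m} {suc n} x x-inj f c bound = begin
  sum f                                                 ≡⟨ sum-remove {i = y} f ⟩
  f y + sum (removeAt f y)                              ≤⟨ +-monoʳ-≤ (f y) (sum-≤-image x′ x′-inj (removeAt f y) c bound′) ⟩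
  f y + (∑[ j < m ] f (punchIn y (x′ j)) + (n ∸ m) * c) ≡⟨ cong (λ s → f y + (s + (n ∸ m) * c)) (sum-cong-≗ x′-lifts) ⟩
  f y + (∑[ j < m ] f (x (suc j)) + (n ∸ m) * c)        ≡⟨ +-assoc (f y) _ _ ⟨
  ∑[ j < suc m ] f (x j) + (n ∸ m) * c                  ∎
  where
  open ≤-Reasoning
  y : Fin (suc n)
  y = x zero
  y≢x : ∀ j → y ≢ x (suc j)
  y≢x j = Fin.0≢1+n ∘ x-inj
  x′ : Fin m → Fin n
  x′ j = punchOut (y≢x j)
  x′-lifts : ∀ j → f (punchIn y (x′ j)) ≡ f (x (suc j))
  x′-lifts j = cong f (punchIn-punchOut (y≢x j))
  x′-inj : Injective _≡_ _≡_ x′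
  x′-inj eq = Fin.suc-injective (x-inj (punchOut-injective (y≢x _) (y≢x _) eq))
  bound′ : ∀ u → (∀ j → x′ j ≢ u) → f (punchIn y u) ≤ c
  bound′ u miss = bound (punchIn y u) λ
    { zero    eq → punchInᵢ≢i y u (sym eq)
    ; (suc j) eq → miss j (punchIn-injective y _ _ (trans (punchIn-punchOut (y≢x j)) eq)) }

1≤sum⇒∃1≤ : ∀ {n} (g : Fin n → ℕ) → 1 ≤ sum g → ∃ λ v → 1 ≤ g v
1≤sum⇒∃1≤ {suc n} g 1≤Σ with g zero in eq
... | suc _ = zero , subst (1 ≤_) (sym eq) (s≤s z≤n)
... | zero with 1≤sum⇒∃1≤ (g ∘ suc) 1≤Σ
...   | v , 1≤gv = suc v , 1≤gv

2≤sum⇒∃2≤⊎∃₂1≤ : ∀ {n} (g : Fin n → ℕ) → 2 ≤ sum g →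
                  (∃ λ v → 2 ≤ g v) ⊎ (∃₂ λ v v′ → v ≢ v′ × 1 ≤ g v × 1 ≤ g v′)
2≤sum⇒∃2≤⊎∃₂1≤ {suc n} g 2≤Σ with g zero in eq
... | suc (suc _) = inj₁ (zero , subst (2 ≤_) (sym eq) (s≤s (s≤s z≤n)))
... | suc zero with 1≤sum⇒∃1≤ (g ∘ suc) (≤-pred 2≤Σ)
...   | v , 1≤gv = inj₂ (zero , suc v , Fin.0≢1+n , subst (1 ≤_) (sym eq) (s≤s z≤n) , 1≤gv)
2≤sum⇒∃2≤⊎∃₂1≤ {suc n} g 2≤Σ | zero with 2≤sum⇒∃2≤⊎∃₂1≤ (g ∘ suc) 2≤Σ
...   | inj₁ (v , 2≤gv) = inj₁ (suc v , 2≤gv)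
...   | inj₂ (v , v′ , v≢v′ , 1≤gv , 1≤gv′) = inj₂ (suc v , suc v′ , v≢v′ ∘ Fin.suc-injective , 1≤gv , 1≤gv′)

argmax : ∀ {n} (f : Fin n → ℕ) → Fin n → ∃ λ z → ∀ v → f v ≤ f z
argmax {suc zero}    f _ = zero , λ { zero → ≤-refl }
argmax {suc (suc n)} f _ with argmax (f ∘ suc) zero
... | z , f≤fz with f zero ≤? f (suc z)
...   | yes f0≤fz = suc z , λ { zero → f0≤fz ; (suc v) → f≤fz v }
...   | no  f0≰fz = zero  , λ { zero → ≤-refl ; (suc v) → ≤-trans (f≤fz v) (<⇒≤ (≰⇒> f0≰fz)) }

geometric : ∀ e → suc (∑[ i < e ] (2 ^ toℕ i)) ≡ 2 ^ e
geometric zero    = refl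
geometric (suc e) = begin
  2 + ∑[ i < e ] (2 * 2 ^ toℕ i)    ≡⟨ cong (2 +_) (*-distribˡ-sum {e} 2 (λ i → 2 ^ toℕ i)) ⟨
  2 + 2 * ∑[ i < e ] (2 ^ toℕ i)    ≡⟨ *-distribˡ-+ 2 1 _ ⟨
  2 * suc (∑[ i < e ] (2 ^ toℕ i))  ≡⟨ cong (2 *_) (geometric e) ⟩
  2 * 2 ^ e                         ∎
  where open ≡-Reasoning

⌊2*n/2⌋≡n : ∀ n → ⌊ 2 * n /2⌋ ≡ n
⌊2*n/2⌋≡n n = trans (cong (λ m → ⌊ n + m /2⌋) (+-identityʳ n)) (sym (n≡⌊n+n/2⌋ n))

sum-halved-powers : ∀ e → ∑[ j < suc e ] ⌊ 2 ^ toℕ j /2⌋ ≡ ∑[ i < e ] (2 ^ toℕ i)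
sum-halved-powers e = sum-cong-≗ {e} (λ i → ⌊2*n/2⌋≡n (2 ^ toℕ i))

m∸a+b+a≡m+b : ∀ {m a} b → a ≤ m → m ∸ a + b + a ≡ m + b
m∸a+b+a≡m+b {m} {a} b a≤m = begin
  m ∸ a + b + a    ≡⟨ +-assoc (m ∸ a) b a ⟩
  m ∸ a + (b + a)  ≡⟨ cong (m ∸ a +_) (+-comm b a) ⟩
  m ∸ a + (a + b)  ≡⟨ +-assoc (m ∸ a) a b ⟨
  m ∸ a + a + b    ≡⟨ cong (_+ b) (m∸n+n≡m a≤m) ⟩
  m + b            ∎
  where open ≡-Reasoning

m+2≡n+1⇒m<n : ∀ {m n} → m + 2 ≡ n + 1 → m < n
m+2≡n+1⇒m<n {m} {n} eq = ≤-reflexive (+-cancelʳ-≡ 1 (suc m) n (trans (sym (+-suc m 1)) eq))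

n<2^n : ∀ n → n < 2 ^ n
n<2^n zero    = s≤s z≤n
n<2^n (suc n) = +-mono-≤ (m^n>0 2 n) (≤-trans (n<2^n n) (m≤m+n (2 ^ n) 0))

2^n≤2*2^[n∸1] : ∀ n → 2 ^ n ≤ 2 * 2 ^ (n ∸ 1)
2^n≤2*2^[n∸1] zero    = s≤s z≤n
2^n≤2*2^[n∸1] (suc n) = ≤-refl

⌊n/2⌋≤n∸1 : ∀ n → ⌊ n /2⌋ ≤ n ∸ 1
⌊n/2⌋≤n∸1 zero    = z≤n
⌊n/2⌋≤n∸1 (suc n) = ≤-pred (⌊n/2⌋<n n)

2^e+k*M≤2^[e+k] : ∀ e k {M} → M ≤ 2 ^ e → 2 ^ e + k * M ≤ 2 ^ (e + k)
2^e+k*M≤2^[e+k] e k {M} M≤2^e = begin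
  2 ^ e + k * M      ≤⟨ +-monoʳ-≤ (2 ^ e) (*-monoʳ-≤ k M≤2^e) ⟩
  suc k * 2 ^ e      ≤⟨ *-monoˡ-≤ (2 ^ e) (n<2^n k) ⟩
  2 ^ k * 2 ^ e      ≡⟨ *-comm (2 ^ k) (2 ^ e) ⟩
  2 ^ e * 2 ^ k      ≡⟨ ^-distribˡ-+-* 2 e k ⟨
  2 ^ (e + k)        ∎
  where open ≤-Reasoning

≤-rubbling-bound : ∀ {n d e M} → e ≤ d → e < n → M ≤ 2 ^ e → M ≤ 2 ^ (d ∸ 1) ∸ 1 →
              2 ^ e + (n ∸ suc e) * M ≤ (n ∸ d + 1) * (2 ^ (d ∸ 1) ∸ 1) + 2
≤-rubbling-bound {n} {d} {e} {M} e≤d e<n M≤2^e M≤c with n ≤? d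
... | yes n≤d = begin
  2 ^ e + (n ∸ suc e) * M           ≤⟨ 2^e+k*M≤2^[e+k] e (n ∸ suc e) M≤2^e ⟩
  2 ^ (e + (n ∸ suc e))             ≤⟨ ^-monoʳ-≤ 2 (∸-monoˡ-≤ 1 (≤-trans (≤-reflexive (m+[n∸m]≡n e<n)) n≤d)) ⟩
  2 ^ (d ∸ 1)                       ≡⟨ m∸n+n≡m (m^n>0 2 (d ∸ 1)) ⟨
  c + 1                             ≤⟨ +-monoʳ-≤ c (n≤1+n 1) ⟩
  c + 2                             ≡⟨ cong (_+ 2) (+-identityʳ c) ⟨
  (0 + 1) * c + 2                   ≡⟨ cong (λ k → (k + 1) * c + 2) (m≤n⇒m∸n≡0 n≤d) ⟨
  (n ∸ d + 1) * c + 2               ∎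
  where
  open ≤-Reasoning
  c : ℕ
  c = 2 ^ (d ∸ 1) ∸ 1
... | no n≰d with m≤n⇒∃[o]m+o≡n e≤d | m≤n⇒∃[o]m+o≡n (≰⇒> n≰d)
...   | j , refl | b , refl = begin
  2 ^ e + (n ∸ suc e) * M           ≡⟨ cong (λ k → 2 ^ e + k * M) n∸1+e≡j+b ⟩
  2 ^ e + (j + b) * M               ≡⟨ cong (2 ^ e +_) (*-distribʳ-+ M j b) ⟩
  2 ^ e + (j * M + b * M)           ≡⟨ +-assoc (2 ^ e) (j * M) (b * M) ⟨
  2 ^ e + j * M + b * M             ≤⟨ +-mono-≤ (2^e+k*M≤2^[e+k] e j M≤2^e) (*-monoʳ-≤ b M≤c) ⟩
  2 ^ d + b * c                     ≤⟨ +-monoˡ-≤ (b * c) (2^n≤2*2^[n∸1] d) ⟩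
  2 * 2 ^ (d ∸ 1) + b * c           ≡⟨ cong (λ k → 2 * k + b * c) (m∸n+n≡m (m^n>0 2 (d ∸ 1))) ⟨
  2 * (c + 1) + b * c               ≡⟨ regroup b c ⟩
  (suc b + 1) * c + 2               ≡⟨ cong (λ k → (k + 1) * c + 2) n∸d≡1+b ⟨
  (n ∸ d + 1) * c + 2               ∎
  where
  open ≤-Reasoning
  c : ℕ
  c = 2 ^ (d ∸ 1) ∸ 1
  n∸1+e≡j+b : n ∸ suc e ≡ j + b
  n∸1+e≡j+b = trans (cong (_∸ e) (+-assoc e j b)) (m+n∸m≡n e (j + b))
  n∸d≡1+b : n ∸ d ≡ suc b
  n∸d≡1+b = trans (cong (_∸ d) (sym (+-suc d b))) (m+n∸m≡n d (suc b))
  regroup : ∀ b c → 2 * (c + 1) + b * c ≡ (suc b + 1) * c + 2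
  regroup = solve-∀

weight : ∀ {n} → (Fin n → ℕ) → (Fin n → ℕ) → ℕ
weight {n} w q = ∑[ x < n ] (q x * w x)

weight-transfer : ∀ {n} (w : Fin n → ℕ) {q′ a q b : Fin n → ℕ} →
                  (∀ x → q′ x + a x ≡ q x + b x) →
                  weight w q′ + weight w a ≡ weight w q + weight w b
weight-transfer w {q′} {a} {q} {b} eq = sum-transfer λ x → begin
  q′ x * w x + a x * w x  ≡⟨ *-distribʳ-+ (w x) (q′ x) (a x) ⟨
  (q′ x + a x) * w x      ≡⟨ cong (_* w x) (eq x) ⟩
  (q x + b x) * w x       ≡⟨ *-distribʳ-+ (w x) (q x) (b x) ⟩
  q x * w x + b x * w x   ∎
  where open ≡-Reasoning

weight-scale : ∀ {n} (w : Fin n → ℕ) c (a : Fin n → ℕ) → weight w (λ x → c * a x) ≡ c * weight w a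
weight-scale w c a = trans (sum-cong-≗ (λ x → *-assoc c (a x) (w x))) (sym (*-distribˡ-sum c (λ x → a x * w x)))

weight-+ : ∀ {n} (w a b : Fin n → ℕ) → weight w (λ x → a x + b x) ≡ weight w a + weight w b
weight-+ w a b = trans (sum-cong-≗ (λ x → *-distribʳ-+ (w x) (a x) (b x))) (∑-distrib-+ (λ x → a x * w x) (λ x → b x * w x))

weight-one : ∀ {n} (q : Fin n → ℕ) → weight (λ _ → 1) q ≡ sum q
weight-one q = sum-cong-≗ (λ x → *-identityʳ (q x))

module Moves {n : ℕ} (G : Graph n) where

  infix 8 _≐_
  _≐_ : Fin n → Fin n → ℕ
  _≐_ = _at_ G

  ≐-cases : ∀ x v → (x ≡ v × x ≐ v ≡ 1) ⊎ (x ≢ v × x ≐ v ≡ 0)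
  ≐-cases x v with x ≟ v
  ... | yes x≡v = inj₁ (x≡v , refl)
  ... | no  x≢v = inj₂ (x≢v , refl)

  ≐-refl : ∀ v → v ≐ v ≡ 1
  ≐-refl v with ≐-cases v v
  ... | inj₁ (_ , ≐≡1)  = ≐≡1
  ... | inj₂ (v≢v , _)   = ⊥-elim (v≢v refl)

  weight-at : ∀ (w : Fin n → ℕ) v → weight w (λ x → x ≐ v) ≡ w v
  weight-at w v = trans (sum-point _ v vanish) (trans (cong (_* w v) (≐-refl v)) (+-identityʳ (w v)))
    where
    vanish : ∀ x → x ≢ v → x ≐ v * w x ≡ 0
    vanish x x≢v with ≐-cases x v
    ... | inj₁ (x≡v , _)  = ⊥-elim (x≢v x≡v)
    ... | inj₂ (_ , ≐≡0) = cong (_* w x) ≐≡0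

  pebble : Distribution G → Fin n → Fin n → Distribution G
  pebble q v u x = q x ∸ 2 * x ≐ v + x ≐ u

  rubble : Distribution G → Fin n → Fin n → Fin n → Distribution G
  rubble q v v′ u x = q x ∸ x ≐ v ∸ x ≐ v′ + x ≐ u

  weight-pebble : ∀ w {q q′ : Distribution G} v u → 2 ≤ q v → (∀ x → q′ x ≡ pebble q v u x) →
                  weight w q′ + 2 * w v ≡ weight w q + w u
  weight-pebble w {q} {q′} v u 2≤qv q′≡ = begin
    weight w q′ + 2 * w v                     ≡⟨ cong (λ s → weight w q′ + 2 * s) (weight-at w v) ⟨
    weight w q′ + 2 * weight w (λ x → x ≐ v)  ≡⟨ cong (weight w q′ +_) (weight-scale w 2 (λ x → x ≐ v)) ⟨
    weight w q′ + weight w (λ x → 2 * x ≐ v)  ≡⟨ weight-transfer w {q′} {λ x → 2 * x ≐ v} {q} conserves ⟩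
    weight w q + weight w (λ x → x ≐ u)       ≡⟨ cong (weight w q +_) (weight-at w u) ⟩
    weight w q + w u                          ∎
    where
    open ≡-Reasoning
    removed≤ : ∀ x → 2 * x ≐ v ≤ q x
    removed≤ x with ≐-cases x v
    ... | inj₁ (refl , ≐≡1) rewrite ≐≡1 = 2≤qv
    ... | inj₂ (_ , ≐≡0)    rewrite ≐≡0 = z≤n
    conserves : ∀ x → q′ x + 2 * x ≐ v ≡ q x + x ≐ u
    conserves x = trans (cong (_+ 2 * x ≐ v) (q′≡ x)) (m∸a+b+a≡m+b (x ≐ u) (removed≤ x))

  weight-rubble : ∀ w {q q′ : Distribution G} v v′ u → v ≢ v′ → 1 ≤ q v → 1 ≤ q v′ →
                  (∀ x → q′ x ≡ rubble q v v′ u x) →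
                  weight w q′ + (w v + w v′) ≡ weight w q + w u
  weight-rubble w {q} {q′} v v′ u v≢v′ 1≤qv 1≤qv′ q′≡ = begin
    weight w q′ + (w v + w v′)
      ≡⟨ cong (weight w q′ +_) (cong₂ _+_ (weight-at w v) (weight-at w v′)) ⟨
    weight w q′ + (weight w (λ x → x ≐ v) + weight w (λ x → x ≐ v′))
      ≡⟨ cong (weight w q′ +_) (weight-+ w (λ x → x ≐ v) (λ x → x ≐ v′)) ⟨
    weight w q′ + weight w (λ x → x ≐ v + x ≐ v′)
      ≡⟨ weight-transfer w {q′} {λ x → x ≐ v + x ≐ v′} {q} conserves ⟩
    weight w q + weight w (λ x → x ≐ u)
      ≡⟨ cong (weight w q +_) (weight-at w u) ⟩
    weight w q + w u
      ∎
    where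
    open ≡-Reasoning
    removed≤ : ∀ x → x ≐ v + x ≐ v′ ≤ q x
    removed≤ x with ≐-cases x v | ≐-cases x v′
    ... | inj₁ (refl , _)   | inj₁ (refl , _)   = ⊥-elim (v≢v′ refl)
    ... | inj₁ (refl , a≡1) | inj₂ (_ , b≡0)    rewrite a≡1 | b≡0 = 1≤qv
    ... | inj₂ (_ , a≡0)    | inj₁ (refl , b≡1) rewrite a≡0 | b≡1 = 1≤qv′
    ... | inj₂ (_ , a≡0)    | inj₂ (_ , b≡0)    rewrite a≡0 | b≡0 = z≤n
    conserves : ∀ x → q′ x + (x ≐ v + x ≐ v′) ≡ q x + x ≐ u
    conserves x = begin
      q′ x + (x ≐ v + x ≐ v′)                            ≡⟨ cong (_+ (x ≐ v + x ≐ v′)) (q′≡ x) ⟩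
      q x ∸ x ≐ v ∸ x ≐ v′ + x ≐ u + (x ≐ v + x ≐ v′)    ≡⟨ cong (λ t → t + x ≐ u + (x ≐ v + x ≐ v′)) (∸-+-assoc (q x) (x ≐ v) (x ≐ v′)) ⟩
      q x ∸ (x ≐ v + x ≐ v′) + x ≐ u + (x ≐ v + x ≐ v′)  ≡⟨ m∸a+b+a≡m+b (x ≐ u) (removed≤ x) ⟩
      q x + x ≐ u                                        ∎

  move-shrinks : ∀ {p q : Distribution G} → Move G p q → sum q < sum p
  move-shrinks {p} {q} move =
    m+2≡n+1⇒m<n (subst₂ (λ a b → a + 2 ≡ b + 1) (weight-one q) (weight-one p) (unit-weights move))
    where
    unit-weights : Move G p q → weight (λ _ → 1) q + 2 ≡ weight (λ _ → 1) p + 1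
    unit-weights (pebbling v u _ 2≤pv q≡)                 = weight-pebble (λ _ → 1) v u 2≤pv q≡
    unit-weights (rubbling v v′ u v≢v′ _ _ 1≤pv 1≤pv′ q≡) = weight-rubble (λ _ → 1) v v′ u v≢v′ 1≤pv 1≤pv′ q≡

  ≐*-positive : ∀ {k m} x y → suc k ≤ x ≐ y * m → x ≡ y × suc k ≤ m
  ≐*-positive {k} {m} x y k<≐*m with ≐-cases x y
  ... | inj₁ (x≡y , ≐≡1) rewrite ≐≡1 = x≡y , subst (suc k ≤_) (+-identityʳ m) k<≐*m
  ... | inj₂ (_ , ≐≡0)   rewrite ≐≡0 = ⊥-elim (n≮0 k<≐*m)

module ShortestPathTree {n : ℕ} (G : Graph n) (r : Fin n) (toRoot : ∀ v → ∃ (Dist G v r)) where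

  open Moves G

  depth : Fin n → ℕ
  depth v = proj₁ (toRoot v)

  shortest : ∀ v → Walk G v r (depth v)
  shortest v = proj₁ (proj₂ (toRoot v))

  depth-minimal : ∀ v k → Walk G v r k → depth v ≤ k
  depth-minimal v = proj₂ (proj₂ (toRoot v))

  next : ∀ {u v k} → Walk G u v k → Fin n
  next {u} here           = u
  next (step {w = w} _ _) = w

  parent : Fin n → Fin n
  parent v = next (shortest v)

  depth-root : depth r ≡ 0
  depth-root = n≤0⇒n≡0 (depth-minimal r 0 here)

  depth≡0⇒root : ∀ {v} → depth v ≡ 0 → v ≡ r
  depth≡0⇒root {v} d≡0 = length0 (subst (Walk G v r) d≡0 (shortest v))
    where
    length0 : ∀ {u} → Walk G u r 0 → u ≡ r
    length0 here = refl

  walk-tail : ∀ {v k} (t : Walk G v r k) → v ≢ r →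
              ∃ λ k′ → k ≡ suc k′ × Adj G v (next t) × Walk G (next t) r k′
  walk-tail here           v≢r = ⊥-elim (v≢r refl)
  walk-tail (step adj t)   _   = _ , refl , adj , t

  parent-adj : ∀ {v} → v ≢ r → Adj G v (parent v)
  parent-adj {v} v≢r = proj₁ (proj₂ (proj₂ (walk-tail (shortest v) v≢r)))

  depth-parent : ∀ {v} → v ≢ r → suc (depth (parent v)) ≡ depth v
  depth-parent {v} v≢r with walk-tail (shortest v) v≢r
  ... | k , d≡1+k , adj , t = ≤-antisym
    (subst (suc (depth (parent v)) ≤_) (sym d≡1+k) (s≤s (depth-minimal (parent v) k t)))
    (depth-minimal v _ (step adj (shortest (parent v))))

  deepest : ∃ λ z → ∀ v → depth v ≤ depth z
  deepest = argmax depth r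

  z : Fin n
  z = proj₁ deepest

  e : ℕ
  e = depth z

  depth≤e : ∀ v → depth v ≤ e
  depth≤e = proj₂ deepest

  w : Fin n → ℕ
  w v = 2 ^ (e ∸ depth v)

  w-parent : ∀ {v} → v ≢ r → w (parent v) ≡ 2 * w v
  w-parent {v} v≢r = cong (2 ^_) (begin
    e ∸ depth (parent v)              ≡⟨ +-∸-assoc 1 (subst (_≤ e) (sym (depth-parent v≢r)) (depth≤e v)) ⟩
    suc (e ∸ suc (depth (parent v)))  ≡⟨ cong (λ d → suc (e ∸ d)) (depth-parent v≢r) ⟩
    suc (e ∸ depth v)                 ∎)
    where open ≡-Reasoning

  half-w-parent : ∀ {v} → v ≢ r → ⌊ w (parent v) /2⌋ ≡ w v
  half-w-parent {v} v≢r = trans (cong ⌊_/2⌋ (w-parent v≢r)) (⌊2*n/2⌋≡n (w v))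

  children : Distribution G → Fin n → ℕ
  children q u = ∑[ v < n ] (parent v ≐ u * q v)

  -- ⌊ w u /2⌋ is the weight of any child of u; it is 0 at depth e, where u has no children.
  W : ℕ
  W = ∑[ u < n ] ⌊ w u /2⌋

  weight-by-children : ∀ q → q r ≡ 0 → weight w q ≡ ∑[ u < n ] (⌊ w u /2⌋ * children q u)
  weight-by-children q qr≡0 = sym (begin
    ∑[ u < n ] (⌊ w u /2⌋ * children q u)                     ≡⟨ sum-cong-≗ (λ u → *-distribˡ-sum {n} ⌊ w u /2⌋ _) ⟩
    ∑[ u < n ] ∑[ v < n ] (⌊ w u /2⌋ * (parent v ≐ u * q v))  ≡⟨ ∑-comm (λ u v → ⌊ w u /2⌋ * (parent v ≐ u * q v)) ⟩
    ∑[ v < n ] ∑[ u < n ] (⌊ w u /2⌋ * (parent v ≐ u * q v))  ≡⟨ sum-cong-≗ passed-to-parent ⟩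
    weight w q                                                ∎)
    where
    open ≡-Reasoning
    passed-to-parent : ∀ v → ∑[ u < n ] (⌊ w u /2⌋ * (parent v ≐ u * q v)) ≡ q v * w v
    passed-to-parent v = trans (sum-point _ (parent v) vanish) at-parent
      where
      vanish : ∀ u → u ≢ parent v → ⌊ w u /2⌋ * (parent v ≐ u * q v) ≡ 0
      vanish u u≢p with ≐-cases (parent v) u
      ... | inj₁ (p≡u , _)  = ⊥-elim (u≢p (sym p≡u))
      ... | inj₂ (_ , ≐≡0) = trans (cong (λ a → ⌊ w u /2⌋ * (a * q v)) ≐≡0) (*-zeroʳ ⌊ w u /2⌋)
      at-parent : ⌊ w (parent v) /2⌋ * (parent v ≐ parent v * q v) ≡ q v * w v
      at-parent rewrite ≐-refl (parent v) | *-identityˡ (q v) with v ≟ r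
      ... | yes refl rewrite qr≡0 = *-zeroʳ ⌊ w (parent r) /2⌋
      ... | no  v≢r  = trans (cong (_* q v) (half-w-parent v≢r)) (*-comm (w v) (q v))

  stuck-weight≤W : ∀ q → q r ≡ 0 → (∀ u → children q u ≤ 1) → weight w q ≤ W
  stuck-weight≤W q qr≡0 stuck = begin
    weight w q                              ≡⟨ weight-by-children q qr≡0 ⟩
    ∑[ u < n ] (⌊ w u /2⌋ * children q u)   ≤⟨ sum-mono-≤ (λ u → *-monoʳ-≤ ⌊ w u /2⌋ (stuck u)) ⟩
    ∑[ u < n ] (⌊ w u /2⌋ * 1)              ≡⟨ sum-cong-≗ (λ u → *-identityʳ ⌊ w u /2⌋) ⟩
    W                                       ∎
    where open ≤-Reasoning

  depth-siblings : ∀ {v v′} → v ≢ r → v′ ≢ r → parent v ≡ parent v′ → depth v ≡ depth v′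
  depth-siblings v≢r v′≢r p≡p′ =
    trans (sym (depth-parent v≢r)) (trans (cong (suc ∘ depth) p≡p′) (depth-parent v′≢r))

  occupied⇒≢root : ∀ {q : Distribution G} {v} → q r ≡ 0 → 1 ≤ q v → v ≢ r
  occupied⇒≢root qr≡0 1≤qv refl = n≮0 (subst (1 ≤_) qr≡0 1≤qv)

  unstick : ∀ q {u} → q r ≡ 0 → 2 ≤ children q u →
            ∃ λ q′ → Move G q q′ × weight w q′ ≡ weight w q
  unstick q {u} qr≡0 2≤ch with 2≤sum⇒∃2≤⊎∃₂1≤ _ 2≤ch
  ... | inj₁ (v , 2≤≐*qv) =
    pebble q v (parent v) ,
    pebbling v (parent v) (parent-adj v≢r) 2≤qv (λ _ → refl) ,
    +-cancelʳ-≡ (2 * w v) _ _ (begin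
      weight w (pebble q v (parent v)) + 2 * w v  ≡⟨ weight-pebble w v (parent v) 2≤qv (λ _ → refl) ⟩
      weight w q + w (parent v)                  ≡⟨ cong (weight w q +_) (w-parent v≢r) ⟩
      weight w q + 2 * w v                       ∎)
    where
    open ≡-Reasoning
    2≤qv : 2 ≤ q v
    2≤qv = proj₂ (≐*-positive (parent v) u 2≤≐*qv)
    v≢r : v ≢ r
    v≢r = occupied⇒≢root qr≡0 (≤-trans (n≤1+n 1) 2≤qv)
  ... | inj₂ (v , v′ , v≢v′ , 1≤≐*qv , 1≤≐*qv′) =
    rubble q v v′ (parent v) ,
    rubbling v v′ (parent v) v≢v′ (parent-adj v≢r) v′-adj 1≤qv 1≤qv′ (λ _ → refl) ,
    +-cancelʳ-≡ (w v + w v′) _ _ (begin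
      weight w (rubble q v v′ (parent v)) + (w v + w v′)  ≡⟨ weight-rubble w v v′ (parent v) v≢v′ 1≤qv 1≤qv′ (λ _ → refl) ⟩
      weight w q + w (parent v)                          ≡⟨ cong (weight w q +_) (w-parent v≢r) ⟩
      weight w q + (w v + (w v + 0))                     ≡⟨ cong (λ x → weight w q + (w v + x)) (trans (+-identityʳ (w v)) w≡w′) ⟩
      weight w q + (w v + w v′)                          ∎)
    where
    open ≡-Reasoning
    1≤qv : 1 ≤ q v
    1≤qv = proj₂ (≐*-positive (parent v) u 1≤≐*qv)
    1≤qv′ : 1 ≤ q v′
    1≤qv′ = proj₂ (≐*-positive (parent v′) u 1≤≐*qv′)
    p≡p′ : parent v ≡ parent v′
    p≡p′ = trans (proj₁ (≐*-positive (parent v) u 1≤≐*qv)) (sym (proj₁ (≐*-positive (parent v′) u 1≤≐*qv′)))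
    v≢r : v ≢ r
    v≢r = occupied⇒≢root qr≡0 1≤qv
    v′≢r : v′ ≢ r
    v′≢r = occupied⇒≢root qr≡0 1≤qv′
    v′-adj : Adj G v′ (parent v)
    v′-adj = subst (Adj G v′) (sym p≡p′) (parent-adj v′≢r)
    w≡w′ : w v ≡ w v′
    w≡w′ = cong (λ d → 2 ^ (e ∸ d)) (depth-siblings v≢r v′≢r p≡p′)

  progress : ∀ q → W < weight w q → 1 ≤ q r ⊎ ∃ λ q′ → Move G q q′ × weight w q′ ≡ weight w q
  progress q heavy with q r in qr≡
  ... | suc _ = inj₁ (s≤s z≤n)
  ... | zero with any? (λ u → 2 ≤? children q u)
  ...   | yes (_ , 2≤ch) = inj₂ (unstick q qr≡ 2≤ch)
  ...   | no  none       = ⊥-elim (<⇒≱ heavy (stuck-weight≤W q qr≡ λ u → ≤-pred (≰⇒> (none ∘ (u ,_)))))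

  heavy⇒reachable : ∀ q → W < weight w q → Reachable G q r
  heavy⇒reachable q = go q (<-wellFounded (sum q))
    where
    go : ∀ q → Acc _<_ (sum q) → W < weight w q → Reachable G q r
    go q (acc smaller) heavy with progress q heavy
    ... | inj₁ 1≤qr = q , ε , 1≤qr
    ... | inj₂ (q′ , move , same) with go q′ (smaller (move-shrinks move)) (subst (W <_) (sym same) heavy)
    ...   | q″ , moves , 1≤q″r = q″ , move ◅ moves , 1≤q″r

  sum≤weight : ∀ q → sum q ≤ weight w q
  sum≤weight q = sum-mono-≤ λ x → begin
    q x      ≡⟨ *-identityʳ (q x) ⟨
    q x * 1  ≤⟨ *-monoʳ-≤ (q x) (m^n>0 2 (e ∸ depth x)) ⟩
    q x * w x ∎
    where open ≤-Reasoning

  ancestor : ℕ → Fin n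
  ancestor zero    = z
  ancestor (suc j) = parent (ancestor j)

  depth-ancestor : ∀ {j} → j ≤ e → depth (ancestor j) ≡ e ∸ j
  depth-ancestor {zero}  _   = refl
  depth-ancestor {suc j} j<e = suc-injective (trans (depth-parent a≢r) depth-a)
    where
    a : Fin n
    a = ancestor j
    depth-a : depth a ≡ suc (e ∸ suc j)
    depth-a = trans (depth-ancestor (≤-trans (n≤1+n j) j<e)) (+-∸-assoc 1 j<e)
    a≢r : a ≢ r
    a≢r a≡r = 1+n≢0 (trans (sym depth-a) (trans (cong depth a≡r) depth-root))

  path : Fin (suc e) → Fin n
  path j = ancestor (toℕ j)

  depth-path : ∀ j → depth (path j) ≡ e ∸ toℕ j
  depth-path j = depth-ancestor (toℕ≤pred[n] j)

  path-injective : Injective _≡_ _≡_ path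
  path-injective {i} {j} eq = toℕ-injective (∸-cancelˡ-≡ (toℕ≤pred[n] i) (toℕ≤pred[n] j)
    (trans (sym (depth-path i)) (trans (cong depth eq) (depth-path j))))

  path-ends-at-root : path (fromℕ e) ≡ r
  path-ends-at-root = depth≡0⇒root (trans (depth-path (fromℕ e)) (trans (cong (e ∸_) (toℕ-fromℕ e)) (n∸n≡0 e)))

  M : ℕ
  M = ⌊ 2 ^ (e ∸ 1) /2⌋

  off-path-bound : ∀ u → (∀ j → path j ≢ u) → ⌊ w u /2⌋ ≤ M
  off-path-bound u off = ⌊n/2⌋-mono (^-monoʳ-≤ 2 (∸-monoʳ-≤ e 1≤depth))
    where
    1≤depth : 1 ≤ depth u
    1≤depth = n≢0⇒n>0 λ d≡0 → off (fromℕ e) (trans path-ends-at-root (sym (depth≡0⇒root d≡0)))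

  1+e≤n : suc e ≤ n
  1+e≤n = injective⇒≤ path-injective

  W<2^e+[n∸1+e]*M : W < 2 ^ e + (n ∸ suc e) * M
  W<2^e+[n∸1+e]*M = begin
    suc W                                                    ≤⟨ s≤s (sum-≤-image path path-injective (λ u → ⌊ w u /2⌋) M off-path-bound) ⟩
    suc (∑[ j < suc e ] ⌊ w (path j) /2⌋ + (n ∸ suc e) * M)  ≡⟨ cong (λ s → suc (s + (n ∸ suc e) * M)) on-path ⟩
    suc (∑[ i < e ] (2 ^ toℕ i) + (n ∸ suc e) * M)           ≡⟨ cong (_+ (n ∸ suc e) * M) (geometric e) ⟩
    2 ^ e + (n ∸ suc e) * M                                  ∎
    where
    open ≤-Reasoning
    e∸depth-path : ∀ j → e ∸ depth (path j) ≡ toℕ j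
    e∸depth-path j = trans (cong (e ∸_) (depth-path j)) (m∸[m∸n]≡n (toℕ≤pred[n] j))
    on-path : ∑[ j < suc e ] ⌊ w (path j) /2⌋ ≡ ∑[ i < e ] (2 ^ toℕ i)
    on-path = trans (sum-cong-≗ {suc e} λ j → cong (λ t → ⌊ 2 ^ t /2⌋) (e∸depth-path j)) (sum-halved-powers e)

  M≤2^e : M ≤ 2 ^ e
  M≤2^e = ≤-trans (⌊n/2⌋≤n (2 ^ (e ∸ 1))) (^-monoʳ-≤ 2 (m∸n≤m e 1))

  M≤2^[d∸1]∸1 : ∀ {d} → e ≤ d → M ≤ 2 ^ (d ∸ 1) ∸ 1
  M≤2^[d∸1]∸1 e≤d = ≤-trans (⌊n/2⌋≤n∸1 (2 ^ (e ∸ 1))) (∸-monoˡ-≤ 1 (^-monoʳ-≤ 2 (∸-monoˡ-≤ 1 e≤d)))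

mainTheorem1 : (n : ℕ) → 2 ≤ n → (G : Graph n) → Connected G →
    (d : ℕ) → Diameter G d →
    RubblingNumber≤ G ((n ∸ d + 1) * (2 ^ (d ∸ 1) ∸ 1) + 2)
mainTheorem1 n _ G _ d (bounded , _) = _ , ≤-refl , suffices
  where
  suffices : Suffices G ((n ∸ d + 1) * (2 ^ (d ∸ 1) ∸ 1) + 2)
  suffices p size≡B r = heavy⇒reachable p (begin-strict
    W                                    <⟨ W<2^e+[n∸1+e]*M ⟩
    2 ^ e + (n ∸ suc e) * M              ≤⟨ ≤-rubbling-bound e≤d 1+e≤n M≤2^e (M≤2^[d∸1]∸1 e≤d) ⟩
    (n ∸ d + 1) * (2 ^ (d ∸ 1) ∸ 1) + 2  ≡⟨ size≡B ⟨
    size G p                             ≡⟨ sum-tabulate p ⟩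
    sum p                                ≤⟨ sum≤weight p ⟩
    weight w p                           ∎)
    where
    open ≤-Reasoning
    distance : ∀ v → ∃ (Dist G v r)
    distance v = proj₁ (bounded v r) , proj₂ (proj₂ (bounded v r))
    open ShortestPathTree G r distance
    e≤d : e ≤ d
    e≤d = proj₁ (proj₂ (bounded z r))
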